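{- Let $\Gamma\cup\{\phi\trianglelefteq\psi\}$ be a set of consequence pairs. If $\phi\trianglelefteq\psi\in\mathbf{CL}(\Gamma)$, then every general selection L-frame that validates all consequence pairs in $\Gamma$ validates $\phi\trianglelefteq\psi$.
   Context: Formulas: $\phi::=p\mid\top\mid\bot\mid\phi\wedge\phi\mid\phi\vee\phi\mid\phi\Rightarrow\phi$. $\mathbf{CL}(\Gamma)$ is the smallest set of consequence pairs $\phi\trianglelefteq\psi$ containing $\Gamma$, closed under uniform substitution, containing $p\trianglelefteq\top$, $\bot\trianglelefteq p$, $p\trianglelefteq p$, $p\wedge q\trianglelefteq p$, $p\wedge q\trianglelefteq q$, $p\trianglelefteq p\vee q$, $q\trianglelefteq p\vee q$, $\top\trianglelefteq p\Rightarrow\top$, $p\Rightarrow(q\wedge r)\trianglelefteq(p\Rightarrow q)\wedge(p\Rightarrow r)$, $(p\Rightarrow q)\wedge(p\Rightarrow r)\trianglelefteq p\Rightarrow(q\wedge r)$, and closed under transitivity, $\wedge$-introduction (from $r\trianglelefteq p$, $r\trianglelefteq q$ infer $r\trianglelefteq p\wedge q$), $\vee$-elimination (from $p\trianglelefteq r$, $q\trianglelefteq r$ infer $p\vee q\trianglelefteq r$) and congruence for $\Rightarrow$ in each argument (from $p\trianglelefteq q$, $q\trianglelefteq p$ infer $p\Rightarrow r\trianglelefteq q\Rightarrow r$ and $r\Rightarrow p\trianglelefteq r\Rightarrow q$). Meet-semilattice $(X,1,\curlywedge)$, $x\preccurlyeq y$ iff $x\curlywedge y=x$; filters are upward closed subsets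 closed under finite meets; $\mathcal F(X)$ the set of filters; $p\sqcup q:={\uparrow}\{x\curlywedge y:x\in p,y\in q\}$. A general selection L-frame is $(X,1,\curlywedge,s,A)$ where $A\subseteq\mathcal F(X)$ contains $X$ and $\{1\}$ and is closed under $\cap$, $\sqcup$ and $a\Rightarrow b:=\{x:s(x,a)\subseteq b\}$, and $s:X\times A\to\mathcal F(X)$ satisfies for $a\in A$: $s(1,a)=\{1\}$; $x\preccurlyeq y$ implies $s(y,a)\subseteq s(x,a)$; if $z\in s(x\curlywedge y,a)$ there are $u\in s(x,a)$, $v\in s(y,a)$ with $u\curlywedge v\preccurlyeq z$. An admissible valuation maps letters into $A$. Truth: $x\Vdash p$ iff $x\in V(p)$; $\top$ always; $x\Vdash\bot$ iff $x=1$; $\wedge$ pointwise; $x\Vdash\phi\vee\psi$ iff there are $y\Vdash\phi$, $z\Vdash\psi$ with $y\curlywedge z\preccurlyeq x$; $x\Vdash\phi\Rightarrow\psi$ iff $s(x,[\![\phi]\!])\subseteq[\![\psi]\!]$. The frame validates $\phi\trianglelefteq\psi$ if $[\![\phi]\!]\subseteq[\![\psi]\!]$ under every admissible valuation. -}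

module Defs where

open import Data.Nat using (ℕ)
open import Data.Unit using (⊤)
open import Data.Product using (Σ; _×_; _,_; ∃-syntax)
open import Relation.Binary.PropositionalEquality using (_≡_)
open import Level using (0ℓ)

infixr 5 _⇒_
infixr 6 _∨_
infixr 7 _∧_

data Fm : Set where
  var : ℕ → Fm
  ⊤f  : Fm
  ⊥f  : Fm
  _∧_ : Fm → Fm → Fm
  _∨_ : Fm → Fm → Fm
  _⇒_ : Fm → Fm → Fm

sub : (ℕ → Fm) → Fm → Fm
sub σ (var n) = σ n
sub σ ⊤f      = ⊤f
sub σ ⊥f      = ⊥f
sub σ (φ ∧ ψ) = sub σ φ ∧ sub σ ψ
sub σ (φ ∨ ψ) = sub σ φ ∨ sub σ ψ
sub σ (φ ⇒ ψ) = sub σ φ ⇒ sub σ ψ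

infix 4 _⊴_
record Pair : Set where
  constructor _⊴_
  field
    lhs : Fm
    rhs : Fm

p q r : Fm
p = var 0
q = var 1
r = var 2

data CL (Γ : Pair → Set) : Pair → Set where
  hyp      : ∀ {c} → Γ c → CL Γ c
  subst    : ∀ {φ ψ} (σ : ℕ → Fm) → CL Γ (φ ⊴ ψ) → CL Γ (sub σ φ ⊴ sub σ ψ)
  ax-top   : CL Γ (p ⊴ ⊤f)
  ax-bot   : CL Γ (⊥f ⊴ p)
  ax-refl  : CL Γ (p ⊴ p)
  ax-∧l    : CL Γ (p ∧ q ⊴ p)
  ax-∧r    : CL Γ (p ∧ q ⊴ q)
  ax-∨l    : CL Γ (p ⊴ p ∨ q)
  ax-∨r    : CL Γ (q ⊴ p ∨ q)
  ax-⇒⊤    : CL Γ (⊤f ⊴ p ⇒ ⊤f)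
  ax-⇒∧₁   : CL Γ (p ⇒ (q ∧ r) ⊴ (p ⇒ q) ∧ (p ⇒ r))
  ax-⇒∧₂   : CL Γ ((p ⇒ q) ∧ (p ⇒ r) ⊴ p ⇒ (q ∧ r))
  trans    : ∀ {φ ψ χ} → CL Γ (φ ⊴ ψ) → CL Γ (ψ ⊴ χ) → CL Γ (φ ⊴ χ)
  ∧-intro  : ∀ {φ ψ χ} → CL Γ (χ ⊴ φ) → CL Γ (χ ⊴ ψ) → CL Γ (χ ⊴ φ ∧ ψ)
  ∨-elim   : ∀ {φ ψ χ} → CL Γ (φ ⊴ χ) → CL Γ (ψ ⊴ χ) → CL Γ (φ ∨ ψ ⊴ χ)
  ⇒-congˡ  : ∀ {φ ψ χ} → CL Γ (φ ⊴ ψ) → CL Γ (ψ ⊴ φ) → CL Γ ((φ ⇒ χ) ⊴ (ψ ⇒ χ))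
  ⇒-congʳ  : ∀ {φ ψ χ} → CL Γ (φ ⊴ ψ) → CL Γ (ψ ⊴ φ) → CL Γ ((χ ⇒ φ) ⊴ (χ ⇒ ψ))

Sub : Set → Set₁
Sub X = X → Set

_⊆_ : {X : Set} → Sub X → Sub X → Set
a ⊆ b = ∀ x → a x → b x

_≐_ : {X : Set} → Sub X → Sub X → Set
a ≐ b = (a ⊆ b) × (b ⊆ a)

module _ {X : Set} (𝟙 : X) (_⋏_ : X → X → X) where

  record IsFilter (a : Sub X) : Set where
    field
      up   : ∀ {x y} → x ⋏ y ≡ x → a x → a y
      one  : a 𝟙
      meet : ∀ {x y} → a x → a y → a (x ⋏ y)

  -- p ⊔ q := ↑{x ⋏ y : x ∈ p, y ∈ q}
  join : Sub X → Sub X → Sub X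
  join a b z = ∃[ x ] ∃[ y ] (a x × b y × ((x ⋏ y) ⋏ z ≡ x ⋏ y))

  imp : (X → Sub X → Sub X) → Sub X → Sub X → Sub X
  imp s a b x = s x a ⊆ b

record GSLFrame : Set₁ where
  field
    X    : Set
    𝟙    : X
    _⋏_  : X → X → X
    ⋏-assoc : ∀ x y z → (x ⋏ y) ⋏ z ≡ x ⋏ (y ⋏ z)
    ⋏-comm  : ∀ x y → x ⋏ y ≡ y ⋏ x
    ⋏-idem  : ∀ x → x ⋏ x ≡ x
    ⋏-top   : ∀ x → x ⋏ 𝟙 ≡ x
    A : Sub X → Set
    s : X → Sub X → Sub X
    -- subsets are predicates, so A and s must respect extensional equality
    A-ext : ∀ {a b} → A a → a ≐ b → A b
    s-ext : ∀ {a b} x → A a → a ≐ b → s x a ≐ s x b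
    A-filter : ∀ {a} → A a → IsFilter 𝟙 _⋏_ a
    A-X   : A (λ _ → ⊤)
    A-1   : A (λ x → x ≡ 𝟙)
    A-∩   : ∀ {a b} → A a → A b → A (λ x → a x × b x)
    A-⊔   : ∀ {a b} → A a → A b → A (join 𝟙 _⋏_ a b)
    A-⇒   : ∀ {a b} → A a → A b → A (imp 𝟙 _⋏_ s a b)
    -- s : X × A → 𝓕(X) and its conditions (x ≼ y is x ⋏ y ≡ x)
    s-filter : ∀ {a} x → A a → IsFilter 𝟙 _⋏_ (s x a)
    s-1     : ∀ {a} → A a → s 𝟙 a ≐ (λ x → x ≡ 𝟙)
    s-anti  : ∀ {a x y} → A a → x ⋏ y ≡ x → s y a ⊆ s x a
    s-meet  : ∀ {a x y z} → A a → s (x ⋏ y) a z →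
              ∃[ u ] ∃[ v ] (s x a u × s y a v × ((u ⋏ v) ⋏ z ≡ u ⋏ v))

module Semantics (F : GSLFrame) where
  open GSLFrame F

  Admissible : (ℕ → Sub X) → Set
  Admissible V = ∀ n → A (V n)

  ⟦_⟧ : Fm → (ℕ → Sub X) → Sub X
  ⟦ var n ⟧ V x = V n x
  ⟦ ⊤f ⟧    V x = ⊤
  ⟦ ⊥f ⟧    V x = x ≡ 𝟙
  ⟦ φ ∧ ψ ⟧ V x = ⟦ φ ⟧ V x × ⟦ ψ ⟧ V x
  ⟦ φ ∨ ψ ⟧ V x = ∃[ y ] ∃[ z ] (⟦ φ ⟧ V y × ⟦ ψ ⟧ V z × ((y ⋏ z) ⋏ x ≡ y ⋏ z))
  ⟦ φ ⇒ ψ ⟧ V x = s x (⟦ φ ⟧ V) ⊆ ⟦ ψ ⟧ V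

Validates : GSLFrame → Pair → Set₁
Validates F (φ ⊴ ψ) = ∀ V → Admissible V → ⟦ φ ⟧ V ⊆ ⟦ ψ ⟧ V
  where open Semantics F

module Submission where

open import Defs
open import Data.Nat using (ℕ)
open import Data.Unit using (tt)
open import Data.Product using (_×_; _,_; proj₁; proj₂; swap)
open import Function using (id)
open import Relation.Binary.PropositionalEquality as Eq using (_≡_; cong; module ≡-Reasoning)

-- Truth sets lie in A, so n ↦ ⟦σ n⟧ is again an
-- admissible valuation and a substitution instance of a valid pair is valid.
-- The ∨-rules hold because ⟦φ ∨ ψ⟧ is the join of filters (the least filter
-- above both), the ⇒-rules because s respects equality of elements of A.

module _ (F : GSLFrame) where
  open GSLFrame F
  open Semantics F
  open IsFilter

  ≐-refl : ∀ {a : Sub X} → a ≐ a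
  ≐-refl = (λ _ → id) , (λ _ → id)

  x⋏y⋏x≡x⋏y : ∀ x y → (x ⋏ y) ⋏ x ≡ x ⋏ y
  x⋏y⋏x≡x⋏y x y = begin
    (x ⋏ y) ⋏ x   ≡⟨ ⋏-assoc x y x ⟩
    x ⋏ (y ⋏ x)   ≡⟨ cong (x ⋏_) (⋏-comm y x) ⟩
    x ⋏ (x ⋏ y)   ≡⟨ Eq.sym (⋏-assoc x x y) ⟩
    (x ⋏ x) ⋏ y   ≡⟨ cong (_⋏ y) (⋏-idem x) ⟩
    x ⋏ y         ∎
    where open ≡-Reasoning

  x⋏y⋏y≡x⋏y : ∀ x y → (x ⋏ y) ⋏ y ≡ x ⋏ y
  x⋏y⋏y≡x⋏y x y = Eq.trans (⋏-assoc x y y) (cong (x ⋏_) (⋏-idem y))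

  ∩-mono : ∀ {a a′ b b′ : Sub X} → a ⊆ a′ → b ⊆ b′ →
           (λ x → a x × b x) ⊆ (λ x → a′ x × b′ x)
  ∩-mono f g x (ha , hb) = f x ha , g x hb

  join-mono : ∀ {a a′ b b′} → a ⊆ a′ → b ⊆ b′ → join 𝟙 _⋏_ a b ⊆ join 𝟙 _⋏_ a′ b′
  join-mono f g _ (y , z , hy , hz , y⋏z≼x) = y , z , f y hy , g z hz , y⋏z≼x

  join-upperˡ : ∀ {a b} → IsFilter 𝟙 _⋏_ b → a ⊆ join 𝟙 _⋏_ a b
  join-upperˡ b-filter x ha = x , 𝟙 , ha , one b-filter , x⋏y⋏x≡x⋏y x 𝟙

  join-upperʳ : ∀ {a b} → IsFilter 𝟙 _⋏_ a → b ⊆ join 𝟙 _⋏_ a b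
  join-upperʳ a-filter x hb = 𝟙 , x , one a-filter , hb , x⋏y⋏y≡x⋏y 𝟙 x

  join-least : ∀ {a b c} → IsFilter 𝟙 _⋏_ c → a ⊆ c → b ⊆ c → join 𝟙 _⋏_ a b ⊆ c
  join-least c-filter f g x (y , z , hy , hz , y⋏z≼x) =
    up c-filter y⋏z≼x (meet c-filter (f y hy) (g z hz))

  imp-mono : ∀ {a a′ b b′} → A a → a ≐ a′ → b ⊆ b′ → imp 𝟙 _⋏_ s a b ⊆ imp 𝟙 _⋏_ s a′ b′
  imp-mono a∈A a≐a′ f x h u su = f u (h u (proj₂ (s-ext x a∈A a≐a′) u su))

  ⟦⟧∈A : ∀ φ {V} → Admissible V → A (⟦ φ ⟧ V)
  ⟦⟧∈A (var n) V-adm = V-adm n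
  ⟦⟧∈A ⊤f      V-adm = A-X
  ⟦⟧∈A ⊥f      V-adm = A-1
  ⟦⟧∈A (φ ∧ ψ) V-adm = A-∩ (⟦⟧∈A φ V-adm) (⟦⟧∈A ψ V-adm)
  ⟦⟧∈A (φ ∨ ψ) V-adm = A-⊔ (⟦⟧∈A φ V-adm) (⟦⟧∈A ψ V-adm)
  ⟦⟧∈A (φ ⇒ ψ) V-adm = A-⇒ (⟦⟧∈A φ V-adm) (⟦⟧∈A ψ V-adm)

  ⟦_⟧∘_ : (ℕ → Fm) → (ℕ → Sub X) → ℕ → Sub X
  (⟦ σ ⟧∘ V) n = ⟦ σ n ⟧ V

  ⟦⟧∘-admissible : ∀ σ {V} → Admissible V → Admissible (⟦ σ ⟧∘ V)
  ⟦⟧∘-admissible σ V-adm n = ⟦⟧∈A (σ n) V-adm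

  ⟦sub⟧ : ∀ σ φ {V} → Admissible V → ⟦ sub σ φ ⟧ V ≐ ⟦ φ ⟧ (⟦ σ ⟧∘ V)
  ⟦sub⟧ σ (var n) V-adm = ≐-refl
  ⟦sub⟧ σ ⊤f      V-adm = ≐-refl
  ⟦sub⟧ σ ⊥f      V-adm = ≐-refl
  ⟦sub⟧ σ (φ ∧ ψ) V-adm =
    ∩-mono (proj₁ (⟦sub⟧ σ φ V-adm)) (proj₁ (⟦sub⟧ σ ψ V-adm)) ,
    ∩-mono (proj₂ (⟦sub⟧ σ φ V-adm)) (proj₂ (⟦sub⟧ σ ψ V-adm))
  ⟦sub⟧ σ (φ ∨ ψ) V-adm =
    join-mono (proj₁ (⟦sub⟧ σ φ V-adm)) (proj₁ (⟦sub⟧ σ ψ V-adm)) ,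
    join-mono (proj₂ (⟦sub⟧ σ φ V-adm)) (proj₂ (⟦sub⟧ σ ψ V-adm))
  ⟦sub⟧ σ (φ ⇒ ψ) V-adm =
    imp-mono (⟦⟧∈A (sub σ φ) V-adm) (⟦sub⟧ σ φ V-adm) (proj₁ (⟦sub⟧ σ ψ V-adm)) ,
    imp-mono (⟦⟧∈A φ (⟦⟧∘-admissible σ V-adm)) (swap (⟦sub⟧ σ φ V-adm))
             (proj₂ (⟦sub⟧ σ ψ V-adm))

  validates-sub : ∀ {φ ψ} σ → Validates F (φ ⊴ ψ) → Validates F (sub σ φ ⊴ sub σ ψ)
  validates-sub {φ} {ψ} σ φ⊆ψ V V-adm x h =
    proj₂ (⟦sub⟧ σ ψ V-adm) x
      (φ⊆ψ (⟦ σ ⟧∘ V) (⟦⟧∘-admissible σ V-adm) x (proj₁ (⟦sub⟧ σ φ V-adm) x h))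

  CL-sound : ∀ {Γ c} → (∀ c → Γ c → Validates F c) → CL Γ c → Validates F c
  CL-sound Γ-valid (hyp h)     = Γ-valid _ h
  CL-sound Γ-valid (subst {φ} {ψ} σ d) = validates-sub {φ} {ψ} σ (CL-sound Γ-valid d)
  CL-sound Γ-valid ax-top  V V-adm x _        = tt
  CL-sound Γ-valid ax-bot  V V-adm x Eq.refl  = one (A-filter (V-adm 0))
  CL-sound Γ-valid ax-refl V V-adm x h        = h
  CL-sound Γ-valid ax-∧l   V V-adm x h        = proj₁ h
  CL-sound Γ-valid ax-∧r   V V-adm x h        = proj₂ h
  CL-sound Γ-valid ax-∨l   V V-adm            = join-upperˡ (A-filter (V-adm 1))
  CL-sound Γ-valid ax-∨r   V V-adm            = join-upperʳ (A-filter (V-adm 0))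
  CL-sound Γ-valid ax-⇒⊤   V V-adm x _ u _    = tt
  CL-sound Γ-valid ax-⇒∧₁  V V-adm x h        =
    (λ u su → proj₁ (h u su)) , (λ u su → proj₂ (h u su))
  CL-sound Γ-valid ax-⇒∧₂  V V-adm x h u su   = proj₁ h u su , proj₂ h u su
  CL-sound Γ-valid (trans d e) V V-adm x h =
    CL-sound Γ-valid e V V-adm x (CL-sound Γ-valid d V V-adm x h)
  CL-sound Γ-valid (∧-intro d e) V V-adm x h =
    CL-sound Γ-valid d V V-adm x h , CL-sound Γ-valid e V V-adm x h
  CL-sound Γ-valid (∨-elim {χ = χ} d e) V V-adm =
    join-least (A-filter (⟦⟧∈A χ V-adm))
      (CL-sound Γ-valid d V V-adm) (CL-sound Γ-valid e V V-adm)
  CL-sound Γ-valid (⇒-congˡ {φ} d e) V V-adm =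
    imp-mono (⟦⟧∈A φ V-adm)
      (CL-sound Γ-valid d V V-adm , CL-sound Γ-valid e V V-adm) (λ _ → id)
  CL-sound Γ-valid (⇒-congʳ {χ = χ} d e) V V-adm =
    imp-mono (⟦⟧∈A χ V-adm) ≐-refl (CL-sound Γ-valid d V V-adm)

theorem3p19 : (Γ : Pair → Set) (φ ψ : Fm) → CL Γ (φ ⊴ ψ) →
    (F : GSLFrame) → (∀ c → Γ c → Validates F c) → Validates F (φ ⊴ ψ)
theorem3p19 Γ φ ψ d F Γ-valid = CL-sound F Γ-valid d
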